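{- Let $v\in\mathcal L(\mathbf p)$, $v\neq\varepsilon$. Then: (1) $v$ is right special with $v1,v2\in\mathcal L(\mathbf p)$ if and only if $v$ is a suffix of $\varphi(w)0$ for some right special $w$ with $w0,w2\in\mathcal L(\mathbf p)$; (2) $v$ is right special with $v0,v2\in\mathcal L(\mathbf p)$ if and only if $v$ is a suffix of $\varphi(w)$ for some right special $w$ with $w1,w2\in\mathcal L(\mathbf p)$.
   Context: $\varphi$ is the morphism on $\{0,1,2\}^*$ given by $\varphi(0)=01$, $\varphi(1)=21$, $\varphi(2)=0$, and $\mathbf p$ is its infinite fixed point starting with $0$. $\mathcal L(\mathbf u)$ denotes the set of finite factors of an infinite word $\mathbf u$. A factor $w$ is right special if $wa,wb\in\mathcal L(\mathbf u)$ for two distinct letters $a,b$. -}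

module Defs where

open import Data.Nat using (ℕ; zero; suc)
open import Data.List using (List; []; _∷_; _++_; concatMap; length)
open import Data.Product using (∃; _×_)
open import Relation.Binary.PropositionalEquality using (_≡_)
open import Relation.Nullary using (¬_)

data Letter : Set where
  l0 l1 l2 : Letter

Word : Set
Word = List Letter

φ₁ : Letter → Word
φ₁ l0 = l0 ∷ l1 ∷ []
φ₁ l1 = l2 ∷ l1 ∷ []
φ₁ l2 = l0 ∷ []

φ : Word → Word
φ = concatMap φ₁

φ^ : ℕ → Word → Word
φ^ zero w = w
φ^ (suc k) w = φ (φ^ k w)

-- n-th letter of a word (default l0 when out of range)
nth : Word → ℕ → Letter
nth [] _ = l0
nth (a ∷ w) zero = a
nth (a ∷ w) (suc n) = nth w n

-- the fixed point p of φ starting with 0:  p n = n-th letter of φ^(n+1)(0)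
-- (|φ^(n+1)(0)| ≥ n+1 and φ^k(0) is a prefix of φ^(k+1)(0), so this is
-- exactly the n-th letter of the infinite fixed point)
p : ℕ → Letter
p n = nth (φ^ (suc n) (l0 ∷ [])) n

factorAt : ℕ → ℕ → Word
factorAt i zero = []
factorAt i (suc n) = p i ∷ factorAt (suc i) n

InL : Word → Set
InL w = ∃ λ i → factorAt i (length w) ≡ w

RightSpecial : Word → Set
RightSpecial w = ∃ λ a → ∃ λ b → ¬ a ≡ b × InL (w ++ a ∷ []) × InL (w ++ b ∷ [])

IsSuffix : Word → Word → Set
IsSuffix v u = ∃ λ x → x ++ v ≡ u

{-# OPTIONS --safe #-}
-- The two-letter factors of p are 01, 02, 10, 12 and 21; hence 2 is always followed by 1,
-- and a word followed by both 1 and 2 ends in 0.  Since the two-letter images φ 0 = 01 and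
-- φ 1 = 21 end in 1, an occurrence of v followed by a letter other than 1 desubstitutes:
-- v = s φ(m) with s empty or s = 1, where m e is a factor for a letter e such that φ(e)
-- begins with the letter after v (and, when s = 1, so is a m e for some a ∈ {0, 1}).  As φ is
-- injective and no image begins with 1, the two right extensions of v yield the same s and
-- m, and turn into two right extensions of m: 1, 2 of v into 0, 2 of m, and 0, 2 of v into
-- 1, 2 of m.  Then v is a proper suffix of φ(w)0, resp. φ(w), for some w = c m with the
-- same two extensions as m: when s = 1 and both occurrences give the same a, take c = a;
-- otherwise (s empty, or both 0m and 1m occur, so that m is empty or begins with 2) c is
-- the letter in front of m in the antecedent provided by the other half of the statement
-- for the shorter word m, by strong induction on |v|.  Conversely, the images under
-- φ of the two extensions of w give those of φ(w)0, resp. φ(w), using w2 ∈ L ⇒ w21 ∈ L.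

module Submission where

open import Defs
open import Data.Empty using (⊥-elim)
open import Data.List using (List; []; _∷_; _++_; length)
open import Data.List.Properties
  using (++-assoc; ++-identityʳ; ∷-injective; ∷-injectiveˡ; ∷-injectiveʳ; concatMap-++; length-++-≤ʳ)
open import Data.List.Relation.Unary.Linked as Linked using (Linked; []; [-]; _∷_)
open import Data.List.Reverse using (reverseView; []; _∶_∶ʳ_)
open import Data.Nat using (ℕ; zero; suc; _+_; _≤_; _<_; z≤n; s≤s)
open import Data.Nat.Induction using (<-wellFounded)
open import Data.Nat.Properties using (n≤1+n; +-suc; +-comm; +-identityʳ; ≤-trans; m≤n⇒m≤1+n)
open import Data.Product using (∃; ∃₂; _×_; _,_)
open import Data.Sum using (_⊎_; inj₁; inj₂)
open import Function.Base using (case_of_)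
open import Function.Bundles using (_⇔_; mk⇔)
open import Induction.WellFounded using (Acc; acc)
open import Relation.Binary.PropositionalEquality
open import Relation.Nullary using (¬_)

open ≡-Reasoning

φ-++ : ∀ x y → φ (x ++ y) ≡ φ x ++ φ y
φ-++ = concatMap-++ φ₁

φ-∷ : ∀ c z → ∃₂ λ d r → φ (c ∷ z) ≡ d ∷ r
φ-∷ l0 z = l0 , l1 ∷ φ z , refl
φ-∷ l1 z = l2 , l1 ∷ φ z , refl
φ-∷ l2 z = l0 , φ z , refl

φ-head≢l1 : ∀ z t → ¬ φ z ≡ l1 ∷ t
φ-head≢l1 [] t ()
φ-head≢l1 (l0 ∷ z) t ()
φ-head≢l1 (l1 ∷ z) t ()
φ-head≢l1 (l2 ∷ z) t ()

φ-injective : ∀ {m m'} → φ m ≡ φ m' → m ≡ m'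
φ-injective {[]}     {[]}      eq = refl
φ-injective {l0 ∷ m} {l0 ∷ m'} eq = cong (l0 ∷_) (φ-injective (∷-injectiveʳ (∷-injectiveʳ eq)))
φ-injective {l1 ∷ m} {l1 ∷ m'} eq = cong (l1 ∷_) (φ-injective (∷-injectiveʳ (∷-injectiveʳ eq)))
φ-injective {l2 ∷ m} {l2 ∷ m'} eq = cong (l2 ∷_) (φ-injective (∷-injectiveʳ eq))
φ-injective {l0 ∷ m} {l2 ∷ m'} eq = ⊥-elim (φ-head≢l1 m' (φ m) (sym (∷-injectiveʳ eq)))
φ-injective {l2 ∷ m} {l0 ∷ m'} eq = ⊥-elim (φ-head≢l1 m (φ m') (∷-injectiveʳ eq))
φ-injective {[]}     {l0 ∷ m'} ()
φ-injective {[]}     {l1 ∷ m'} ()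
φ-injective {[]}     {l2 ∷ m'} ()
φ-injective {l0 ∷ m} {[]}      ()
φ-injective {l1 ∷ m} {[]}      ()
φ-injective {l2 ∷ m} {[]}      ()
φ-injective {l0 ∷ m} {l1 ∷ m'} ()
φ-injective {l1 ∷ m} {l0 ∷ m'} ()
φ-injective {l1 ∷ m} {l2 ∷ m'} ()
φ-injective {l2 ∷ m} {l1 ∷ m'} ()

length-φ : ∀ w → length w ≤ length (φ w)
length-φ []       = z≤n
length-φ (l0 ∷ w) = s≤s (m≤n⇒m≤1+n (length-φ w))
length-φ (l1 ∷ w) = s≤s (m≤n⇒m≤1+n (length-φ w))
length-φ (l2 ∷ w) = s≤s (length-φ w)

length-<-++-∷ : ∀ {A : Set} (w : List A) {c r} → length w < length (w ++ c ∷ r)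
length-<-++-∷ []      = s≤s z≤n
length-<-++-∷ (a ∷ w) = s≤s (length-<-++-∷ w)

length-<-φ-++-∷ : ∀ w {c : Letter} {r} → length w < length (φ w ++ c ∷ r)
length-<-φ-++-∷ w {c} {r} = ≤-trans (s≤s (length-φ w)) (length-<-++-∷ (φ w) {c} {r})

length-<-φ-∷ʳ0 : ∀ w → length (w ++ l0 ∷ []) < length (φ (w ++ l0 ∷ []))
length-<-φ-∷ʳ0 []       = s≤s (s≤s z≤n)
length-<-φ-∷ʳ0 (l0 ∷ w) = s≤s (m≤n⇒m≤1+n (length-<-φ-∷ʳ0 w))
length-<-φ-∷ʳ0 (l1 ∷ w) = s≤s (m≤n⇒m≤1+n (length-<-φ-∷ʳ0 w))
length-<-φ-∷ʳ0 (l2 ∷ w) = s≤s (length-<-φ-∷ʳ0 w)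

P : ℕ → Word
P k = φ^ k (l0 ∷ [])

P-grows : ∀ k → ∃₂ λ c r → P (suc k) ≡ P k ++ c ∷ r
P-grows zero = l1 , [] , refl
P-grows (suc k) with P-grows k
... | c , r , eq with φ-∷ c r
... | d , r' , eq' = d , r' , (begin
  φ (P (suc k))           ≡⟨ cong φ eq ⟩
  φ (P k ++ c ∷ r)        ≡⟨ φ-++ (P k) (c ∷ r) ⟩
  P (suc k) ++ φ (c ∷ r)  ≡⟨ cong (P (suc k) ++_) eq' ⟩
  P (suc k) ++ d ∷ r'     ∎)

P-prefix : ∀ m o → ∃ λ r → P (o + m) ≡ P m ++ r
P-prefix m zero = [] , sym (++-identityʳ (P m))
P-prefix m (suc o) with P-prefix m o | P-grows (o + m)
... | r , eq | c , r' , eq' = r ++ c ∷ r' , (begin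
  P (suc o + m)             ≡⟨ eq' ⟩
  P (o + m) ++ c ∷ r'       ≡⟨ cong (_++ c ∷ r') eq ⟩
  (P m ++ r) ++ c ∷ r'      ≡⟨ ++-assoc (P m) r (c ∷ r') ⟩
  P m ++ r ++ c ∷ r'        ∎)

length-P : ∀ k → k < length (P k)
length-P zero = s≤s z≤n
length-P (suc k) with P-grows k
... | c , r , eq = ≤-trans (s≤s (length-P k))
  (subst (λ u → length (P k) < length u) (sym eq) (length-<-++-∷ (P k) {c} {r}))

Infix : Word → Word → Set
Infix u w = ∃₂ λ x y → w ≡ x ++ u ++ y

infix-++⁻ˡ : ∀ u v {w} → Infix (u ++ v) w → Infix u w
infix-++⁻ˡ u v (x , y , eq) = x , v ++ y , trans eq (cong (x ++_) (++-assoc u v y))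

infix-++⁻ʳ : ∀ u v {w} → Infix (u ++ v) w → Infix v w
infix-++⁻ʳ u v {w} (x , y , eq) = x ++ u , y , (begin
  w                    ≡⟨ eq ⟩
  x ++ (u ++ v) ++ y   ≡⟨ cong (x ++_) (++-assoc u v y) ⟩
  x ++ u ++ v ++ y     ≡⟨ ++-assoc x u (v ++ y) ⟨
  (x ++ u) ++ v ++ y   ∎)

infix-++ʳ : ∀ {u w} r → Infix u w → Infix u (w ++ r)
infix-++ʳ {u} {w} r (x , y , eq) = x , y ++ r , (begin
  w ++ r               ≡⟨ cong (_++ r) eq ⟩
  (x ++ u ++ y) ++ r   ≡⟨ ++-assoc x (u ++ y) r ⟩
  x ++ (u ++ y) ++ r   ≡⟨ cong (x ++_) (++-assoc u y r) ⟩
  x ++ u ++ y ++ r     ∎)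

infix-∷ʳ : ∀ {w} x u c y → w ≡ x ++ u ++ c ∷ y → Infix (u ++ c ∷ []) w
infix-∷ʳ x u c y eq = x , y , trans eq (cong (x ++_) (sym (++-assoc u (c ∷ []) y)))

infix-φ : ∀ {u w} → Infix u w → Infix (φ u) (φ w)
infix-φ {u} {w} (x , y , eq) = φ x , φ y , (begin
  φ w                  ≡⟨ cong φ eq ⟩
  φ (x ++ u ++ y)      ≡⟨ φ-++ x (u ++ y) ⟩
  φ x ++ φ (u ++ y)    ≡⟨ cong (φ x ++_) (φ-++ u y) ⟩
  φ x ++ φ u ++ φ y    ∎)

Factor : Word → Set
Factor u = ∃ λ k → Infix u (P k)

factor-++⁻ˡ : ∀ u v → Factor (u ++ v) → Factor u
factor-++⁻ˡ u v (k , o) = k , infix-++⁻ˡ u v o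

factor-++⁻ʳ : ∀ u v → Factor (u ++ v) → Factor v
factor-++⁻ʳ u v (k , o) = k , infix-++⁻ʳ u v o

factor-φ : ∀ {u} → Factor u → Factor (φ u)
factor-φ (k , o) = suc k , infix-φ o

factor-in-image : ∀ {u} → Factor u → ∃ λ k → Infix u (φ (P k))
factor-in-image (k , o) with P-grows k
... | c , r , eq = k , subst (Infix _) (sym eq) (infix-++ʳ (c ∷ r) o)

factor-extendʳ : ∀ {u} → Factor u → ∃ λ c → Factor (u ++ c ∷ [])
factor-extendʳ {u} (k , x , d ∷ y , eq) = d , k , infix-∷ʳ x u d y eq
factor-extendʳ {u} (k , x , [] , eq) with P-grows k
... | c , r , eq' = c , suc k , infix-∷ʳ x u c r (begin
  P (suc k)                 ≡⟨ eq' ⟩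
  P k ++ c ∷ r              ≡⟨ cong (_++ c ∷ r) eq ⟩
  (x ++ u ++ []) ++ c ∷ r   ≡⟨ ++-assoc x (u ++ []) (c ∷ r) ⟩
  x ++ (u ++ []) ++ c ∷ r   ≡⟨ cong (x ++_) (++-assoc u [] (c ∷ r)) ⟩
  x ++ u ++ c ∷ r           ∎)

-- Two-letter factors

data Adjacent : Letter → Letter → Set where
  adj01 : Adjacent l0 l1
  adj02 : Adjacent l0 l2
  adj10 : Adjacent l1 l0
  adj12 : Adjacent l1 l2
  adj21 : Adjacent l2 l1

linked-φ-∷ : ∀ a z → Linked Adjacent (a ∷ z) → Linked Adjacent (φ (a ∷ z))
linked-φ-∷ l0 []       [-]          = adj01 ∷ [-]
linked-φ-∷ l1 []       [-]          = adj21 ∷ [-]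
linked-φ-∷ l2 []       [-]          = [-]
linked-φ-∷ l0 (l1 ∷ z) (adj01 ∷ ℓ) = adj01 ∷ adj12 ∷ linked-φ-∷ l1 z ℓ
linked-φ-∷ l0 (l2 ∷ z) (adj02 ∷ ℓ) = adj01 ∷ adj10 ∷ linked-φ-∷ l2 z ℓ
linked-φ-∷ l1 (l0 ∷ z) (adj10 ∷ ℓ) = adj21 ∷ adj10 ∷ linked-φ-∷ l0 z ℓ
linked-φ-∷ l1 (l2 ∷ z) (adj12 ∷ ℓ) = adj21 ∷ adj10 ∷ linked-φ-∷ l2 z ℓ
linked-φ-∷ l2 (l1 ∷ z) (adj21 ∷ ℓ) = adj02 ∷ linked-φ-∷ l1 z ℓ

linked-φ : ∀ {z} → Linked Adjacent z → Linked Adjacent (φ z)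
linked-φ {[]}    [] = []
linked-φ {a ∷ z} ℓ  = linked-φ-∷ a z ℓ

linked-P : ∀ k → Linked Adjacent (P k)
linked-P zero    = [-]
linked-P (suc k) = linked-φ (linked-P k)

linked-infix : ∀ {A : Set} {R : A → A → Set} x {a b y} → Linked R (x ++ a ∷ b ∷ y) → R a b
linked-infix []      ℓ = Linked.head ℓ
linked-infix (c ∷ x) ℓ = linked-infix x (Linked.tail ℓ)

factor-adjacent : ∀ {a b} → Factor (a ∷ b ∷ []) → Adjacent a b
factor-adjacent (k , x , y , eq) = linked-infix x (subst (Linked Adjacent) eq (linked-P k))

factor-∷ʳ-adjacent : ∀ v {a b} → Factor ((v ++ a ∷ []) ++ b ∷ []) → Adjacent a b
factor-∷ʳ-adjacent v {a} {b} f =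
  factor-adjacent (factor-++⁻ʳ v _ (subst Factor (++-assoc v (a ∷ []) (b ∷ [])) f))

factor-2-1 : ∀ u → Factor (u ++ l2 ∷ []) → Factor (u ++ l2 ∷ l1 ∷ [])
factor-2-1 u f with factor-extendʳ f
... | c , f' with factor-∷ʳ-adjacent u f'
... | adj21 = subst Factor (++-assoc u (l2 ∷ []) (l1 ∷ [])) f'

record OccursAt (o : ℕ) (w : Word) : Set where
  constructor occursAt
  field nth≡p : ∀ j → j < length w → nth w j ≡ p (o + j)

nth-++ : ∀ w r j → j < length w → nth (w ++ r) j ≡ nth w j
nth-++ (a ∷ w) r zero    _         = refl
nth-++ (a ∷ w) r (suc j) (s≤s j<) = nth-++ w r j j<

P-nth : ∀ k j → j < length (P k) → nth (P k) j ≡ p j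
P-nth k j j< with P-prefix k (suc j) | P-prefix (suc j) k
... | r , eq | r' , eq' = begin
  nth (P k) j                ≡⟨ nth-++ (P k) r j j< ⟨
  nth (P k ++ r) j           ≡⟨ cong (λ w → nth w j) eq ⟨
  nth (P (suc j + k)) j      ≡⟨ cong (λ n → nth (P n) j) (+-comm (suc j) k) ⟩
  nth (P (k + suc j)) j      ≡⟨ cong (λ w → nth w j) eq' ⟩
  nth (P (suc j) ++ r') j    ≡⟨ nth-++ (P (suc j)) r' j (≤-trans (n≤1+n (suc j)) (length-P (suc j))) ⟩
  p j                        ∎

P-occursAt-0 : ∀ k → OccursAt 0 (P k)
P-occursAt-0 k = occursAt (P-nth k)

occursAt-head : ∀ {o c w} → OccursAt o (c ∷ w) → c ≡ p o
occursAt-head {o} (occursAt h) = trans (h 0 (s≤s z≤n)) (cong p (+-identityʳ o))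

occursAt-tail : ∀ {o c w} → OccursAt o (c ∷ w) → OccursAt (suc o) w
occursAt-tail {o} (occursAt h) = occursAt λ j j< → trans (h (suc j) (s≤s j<)) (cong p (+-suc o j))

occursAt-++⁻ʳ : ∀ x {o w} → OccursAt o (x ++ w) → OccursAt (length x + o) w
occursAt-++⁻ʳ []          h = h
occursAt-++⁻ʳ (c ∷ x) {o} {w} h =
  subst (λ n → OccursAt n w) (+-suc (length x) o) (occursAt-++⁻ʳ x (occursAt-tail h))

occursAt-factorAt : ∀ u {o y} → OccursAt o (u ++ y) → factorAt o (length u) ≡ u
occursAt-factorAt []      h = refl
occursAt-factorAt (c ∷ u) h = cong₂ _∷_ (sym (occursAt-head h)) (occursAt-factorAt u (occursAt-tail h))

occursAt-prefix : ∀ n w {o} → n ≤ length w → OccursAt o w → ∃ λ y → w ≡ factorAt o n ++ y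
occursAt-prefix zero    w       _         _ = w , refl
occursAt-prefix (suc n) (c ∷ w) (s≤s n≤) h with occursAt-prefix n w n≤ (occursAt-tail h)
... | y , eq = y , cong₂ _∷_ (occursAt-head h) eq

occursAt-infix : ∀ i n w {o} → i + n ≤ length w → OccursAt o w → Infix (factorAt (i + o) n) w
occursAt-infix zero    n w       le h with occursAt-prefix n w le h
... | y , eq = [] , y , eq
occursAt-infix (suc i) n (c ∷ w) {o} (s≤s le) h with occursAt-infix i n w le (occursAt-tail h)
... | x , y , eq = c ∷ x , y , cong (c ∷_) (subst (λ m → w ≡ x ++ factorAt m n ++ y) (+-suc i o) eq)

factor⇒inL : ∀ {u} → Factor u → InL u
factor⇒inL {u} (k , x , y , eq) =
  length x + 0 , occursAt-factorAt u (occursAt-++⁻ʳ x (subst (OccursAt 0) eq (P-occursAt-0 k)))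

inL⇒factor : ∀ {u} → InL u → Factor u
inL⇒factor {u} (i , eq) = k , subst (λ w → Infix w (P k)) factorAt≡u
  (occursAt-infix i (length u) (P k) (≤-trans (n≤1+n k) (length-P k)) (P-occursAt-0 k))
  where
  k = i + length u
  factorAt≡u : factorAt (i + 0) (length u) ≡ u
  factorAt≡u = trans (cong (λ o → factorAt o (length u)) (+-identityʳ i)) eq

-- Desubstitution

-- Both two-letter images end in 1, so a cut of φ z in front of a letter other than 1
-- falls between the images of two letters.
φ-split : ∀ z y b t → ¬ b ≡ l1 → φ z ≡ y ++ b ∷ t →
          ∃₂ λ m z₁ → z ≡ m ++ z₁ × y ≡ φ m × φ z₁ ≡ b ∷ t
φ-split z        []          b t _   eq = [] , z , refl , refl , eq
φ-split []       (c ∷ y)     b t _   ()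
φ-split (l0 ∷ z) (c ∷ [])    b t b≢1 eq = ⊥-elim (b≢1 (sym (∷-injectiveˡ (∷-injectiveʳ eq))))
φ-split (l1 ∷ z) (c ∷ [])    b t b≢1 eq = ⊥-elim (b≢1 (sym (∷-injectiveˡ (∷-injectiveʳ eq))))
φ-split (l0 ∷ z) (c ∷ d ∷ y) b t b≢1 eq with ∷-injective eq
... | refl , eq₁ with ∷-injective eq₁
... | refl , eq₂ with φ-split z y b t b≢1 eq₂
... | m , z₁ , refl , refl , eq₃ = l0 ∷ m , z₁ , refl , refl , eq₃
φ-split (l1 ∷ z) (c ∷ d ∷ y) b t b≢1 eq with ∷-injective eq
... | refl , eq₁ with ∷-injective eq₁
... | refl , eq₂ with φ-split z y b t b≢1 eq₂
... | m , z₁ , refl , refl , eq₃ = l1 ∷ m , z₁ , refl , refl , eq₃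
φ-split (l2 ∷ z) (c ∷ y)     b t b≢1 eq with ∷-injective eq
... | refl , eq₁ with φ-split z y b t b≢1 eq₁
... | m , z₁ , refl , refl , eq₂ = l2 ∷ m , z₁ , refl , refl , eq₂

-- ImageTail z s: s is the part of the image of the last letter of z that lies after a cut,
-- that is, empty or the final 1 of φ 0 = 01 or φ 1 = 21.
data ImageTail : Word → Word → Set where
  none : ∀ {z} → ImageTail z []
  one  : ∀ z {a} → ¬ a ≡ l2 → ImageTail (z ++ a ∷ []) (l1 ∷ [])

imageTail-∷ : ∀ c {z s} → ImageTail z s → ImageTail (c ∷ z) s
imageTail-∷ c none         = none
imageTail-∷ c (one z a≢2) = one (c ∷ z) a≢2

image-suffix : ∀ z x y → x ++ y ≡ φ z →
               ∃₂ λ z₀ m → ∃ λ s → z ≡ z₀ ++ m × y ≡ s ++ φ m × ImageTail z₀ s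
image-suffix z        []          y eq = [] , z , [] , refl , eq , none
image-suffix []       (c ∷ x)     y ()
image-suffix (l0 ∷ z) (c ∷ [])    y eq = l0 ∷ [] , z , l1 ∷ [] , refl , ∷-injectiveʳ eq , one [] (λ ())
image-suffix (l1 ∷ z) (c ∷ [])    y eq = l1 ∷ [] , z , l1 ∷ [] , refl , ∷-injectiveʳ eq , one [] (λ ())
image-suffix (l0 ∷ z) (c ∷ d ∷ x) y eq with image-suffix z x y (∷-injectiveʳ (∷-injectiveʳ eq))
... | z₀ , m , s , refl , eq' , τ = l0 ∷ z₀ , m , s , refl , eq' , imageTail-∷ l0 τ
image-suffix (l1 ∷ z) (c ∷ d ∷ x) y eq with image-suffix z x y (∷-injectiveʳ (∷-injectiveʳ eq))
... | z₀ , m , s , refl , eq' , τ = l1 ∷ z₀ , m , s , refl , eq' , imageTail-∷ l1 τ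
image-suffix (l2 ∷ z) (c ∷ x)     y eq with image-suffix z x y (∷-injectiveʳ eq)
... | z₀ , m , s , refl , eq' , τ = l2 ∷ z₀ , m , s , refl , eq' , imageTail-∷ l2 τ

-- An occurrence in p of s ++ φ m followed by the image of e, seen as the image of the
-- factor m e (aligned), or of a m e with s the final 1 of φ a (cut).
data Desubst (m : Word) (e : Letter) : Word → Set where
  aligned : Factor (m ++ e ∷ []) → Desubst m e []
  cut     : ∀ a → ¬ a ≡ l2 → Factor (a ∷ m ++ e ∷ []) → Desubst m e (l1 ∷ [])

desubst-factor : ∀ {m e s} → Desubst m e s → Factor (m ++ e ∷ [])
desubst-factor (aligned f) = f
desubst-factor (cut a _ f) = factor-++⁻ʳ (a ∷ []) _ f

imageTail-desubst : ∀ {z₀ s} m e → ImageTail z₀ s → Factor ((z₀ ++ m) ++ e ∷ []) → Desubst m e s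
imageTail-desubst {z₀} m e none f = aligned (factor-++⁻ʳ z₀ _ (subst Factor (++-assoc z₀ m _) f))
imageTail-desubst m e (one z {a} a≢2) f = cut a a≢2 (factor-++⁻ʳ z _ (subst Factor (begin
  ((z ++ a ∷ []) ++ m) ++ e ∷ []   ≡⟨ ++-assoc (z ++ a ∷ []) m _ ⟩
  (z ++ a ∷ []) ++ m ++ e ∷ []     ≡⟨ ++-assoc z (a ∷ []) _ ⟩
  z ++ a ∷ m ++ e ∷ []             ∎) f))

desubstitute : ∀ v b t → ¬ b ≡ l1 → Factor (v ++ b ∷ t) →
  ∃₂ λ s m → v ≡ s ++ φ m × ∃₂ λ e z → Desubst m e s × ∃ λ y → φ (e ∷ z) ≡ b ∷ t ++ y
desubstitute v b t b≢1 f with factor-in-image f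
... | k , x , y , eq with φ-split (P k) (x ++ v) b (t ++ y) b≢1 (begin
        φ (P k)                   ≡⟨ eq ⟩
        x ++ (v ++ b ∷ t) ++ y    ≡⟨ cong (x ++_) (++-assoc v (b ∷ t) y) ⟩
        x ++ v ++ b ∷ t ++ y      ≡⟨ ++-assoc x v _ ⟨
        (x ++ v) ++ b ∷ t ++ y    ∎)
... | m' , [] , _ , _ , ()
... | m' , e ∷ z , eP , ex , ez with image-suffix m' x v ex
... | z₀ , m , s , refl , refl , τ =
  s , m , refl , e , z , imageTail-desubst m e τ (k , infix-∷ʳ [] (z₀ ++ m) e z eP) , y , ez

desubst-unique : ∀ {s s' m m' e e'} → s ++ φ m ≡ s' ++ φ m' → Desubst m e s → Desubst m' e' s' →
                 s ≡ s' × m ≡ m'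
desubst-unique eq (aligned _) (aligned _) = refl , φ-injective eq
desubst-unique {m = m} {m'} eq (aligned _) (cut _ _ _) = ⊥-elim (φ-head≢l1 m (φ m') eq)
desubst-unique {m = m} {m'} eq (cut _ _ _) (aligned _) = ⊥-elim (φ-head≢l1 m' (φ m) (sym eq))
desubst-unique eq (cut _ _ _) (cut _ _ _) = refl , φ-injective (∷-injectiveʳ eq)

desubst-01 : ∀ v → Factor (v ++ l0 ∷ l1 ∷ []) → ∃₂ λ s m → v ≡ s ++ φ m × Desubst m l0 s
desubst-01 v f with desubstitute v l0 (l1 ∷ []) (λ ()) f
... | s , m , eq , l0 , z , d , _         = s , m , eq , d
... | s , m , eq , l1 , z , d , y , ()
... | s , m , eq , l2 , z , d , y , eq'   = ⊥-elim (φ-head≢l1 z y (∷-injectiveʳ eq'))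

desubst-02 : ∀ v → Factor (v ++ l0 ∷ l2 ∷ []) → ∃₂ λ s m → v ≡ s ++ φ m × Desubst m l2 s
desubst-02 v f with desubstitute v l0 (l2 ∷ []) (λ ()) f
... | s , m , eq , l0 , z , d , y , ()
... | s , m , eq , l1 , z , d , y , ()
... | s , m , eq , l2 , z , d , _         = s , m , eq , d

desubst-2 : ∀ v → Factor (v ++ l2 ∷ []) → ∃₂ λ s m → v ≡ s ++ φ m × Desubst m l1 s
desubst-2 v f with desubstitute v l2 [] (λ ()) f
... | s , m , eq , l0 , z , d , y , ()
... | s , m , eq , l1 , z , d , _         = s , m , eq , d
... | s , m , eq , l2 , z , d , y , ()

desubst-0 : ∀ v → Factor (v ++ l0 ∷ []) → ∃₂ λ s m → v ≡ s ++ φ m × ∃ λ e → ¬ e ≡ l1 × Desubst m e s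
desubst-0 v f with desubstitute v l0 [] (λ ()) f
... | s , m , eq , l0 , z , d , _         = s , m , eq , l0 , (λ ()) , d
... | s , m , eq , l1 , z , d , y , ()
... | s , m , eq , l2 , z , d , _         = s , m , eq , l2 , (λ ()) , d

factor-split-∷ʳ : ∀ u {a t} → Factor (u ++ a ∷ t) → Factor ((u ++ a ∷ []) ++ t)
factor-split-∷ʳ u {a} {t} = subst Factor (sym (++-assoc u (a ∷ []) t))

factor-join-∷ʳ : ∀ u {a t} → Factor ((u ++ a ∷ []) ++ t) → Factor (u ++ a ∷ t)
factor-join-∷ʳ u {a} {t} = subst Factor (++-assoc u (a ∷ []) t)

factor-φ-++ : ∀ w {u} → Factor (w ++ u) → Factor (φ w ++ φ u)
factor-φ-++ w {u} f = subst Factor (φ-++ w u) (factor-φ f)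

Extends : Word → Letter → Letter → Set
Extends v a b = Factor (v ++ a ∷ []) × Factor (v ++ b ∷ [])

extends⇒inL : ∀ {v a b} → Extends v a b → InL (v ++ a ∷ []) × InL (v ++ b ∷ [])
extends⇒inL (fa , fb) = factor⇒inL fa , factor⇒inL fb

inL⇒extends : ∀ {v a b} → InL (v ++ a ∷ []) → InL (v ++ b ∷ []) → Extends v a b
inL⇒extends ia ib = inL⇒factor ia , inL⇒factor ib

extends-suffix : ∀ {v u a b} → IsSuffix v u → Extends u a b → Extends v a b
extends-suffix {v} (x , refl) (fa , fb) =
  factor-++⁻ʳ x _ (subst Factor (++-assoc x v _) fa) , factor-++⁻ʳ x _ (subst Factor (++-assoc x v _) fb)

φ-extends₀₂ : ∀ {w} → Extends w l0 l2 → Extends (φ w ++ l0 ∷ []) l1 l2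
φ-extends₀₂ {w} (f₀ , f₂) =
  factor-split-∷ʳ (φ w) (factor-φ-++ w f₀) ,
  factor-++⁻ˡ _ (l1 ∷ []) (factor-split-∷ʳ (φ w ++ l0 ∷ []) (factor-split-∷ʳ (φ w) (factor-φ-++ w (factor-2-1 w f₂))))

φ-extends₁₂ : ∀ {w} → Extends w l1 l2 → Extends (φ w) l0 l2
φ-extends₁₂ {w} (f₁ , f₂) = factor-φ-++ w f₂ , factor-++⁻ˡ _ (l1 ∷ []) (factor-split-∷ʳ (φ w) (factor-φ-++ w f₁))

extends₁₂-∷ʳ0 : ∀ {v} → ¬ v ≡ [] → Extends v l1 l2 → ∃ λ v' → v ≡ v' ++ l0 ∷ []
extends₁₂-∷ʳ0 {v} v≢[] (f₁ , f₂) with reverseView v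
... | []             = ⊥-elim (v≢[] refl)
... | v' ∶ _ ∶ʳ l0 = v' , refl
... | v' ∶ _ ∶ʳ l1 = case factor-∷ʳ-adjacent v' f₁ of λ ()
... | v' ∶ _ ∶ʳ l2 = case factor-∷ʳ-adjacent v' f₂ of λ ()

extends₀₁⇒[] : ∀ {m} → Extends m l0 l1 → m ≡ []
extends₀₁⇒[] {m} (f₀ , f₁) with reverseView m
... | []             = refl
... | m' ∶ _ ∶ʳ l0 = case factor-∷ʳ-adjacent m' f₀ of λ ()
... | m' ∶ _ ∶ʳ l1 = case factor-∷ʳ-adjacent m' f₁ of λ ()
... | m' ∶ _ ∶ʳ l2 = case factor-∷ʳ-adjacent m' f₀ of λ ()

left-special-head : ∀ {m} → Factor (l0 ∷ m) → Factor (l1 ∷ m) → m ≡ [] ⊎ ∃ λ m' → m ≡ l2 ∷ m'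
left-special-head {[]}     _  _  = inj₁ refl
left-special-head {l0 ∷ m} f₀ _  = case factor-adjacent (factor-++⁻ˡ (l0 ∷ l0 ∷ []) m f₀) of λ ()
left-special-head {l1 ∷ m} _  f₁ = case factor-adjacent (factor-++⁻ˡ (l1 ∷ l1 ∷ []) m f₁) of λ ()
left-special-head {l2 ∷ m} _  _  = inj₂ (m , refl)

extends-head≢l2 : ∀ {c m a b} → Extends (c ∷ l2 ∷ m) a b → ¬ c ≡ l2
extends-head≢l2 {m = m} (f , _) refl = case factor-adjacent (factor-++⁻ˡ (l2 ∷ l2 ∷ []) _ f) of λ ()

cut-extension : ∀ {m e e'} → Desubst m e (l1 ∷ []) → Desubst m e' (l1 ∷ []) →
                (∃ λ c → ¬ c ≡ l2 × Extends (c ∷ m) e e') ⊎ (Factor (l0 ∷ m) × Factor (l1 ∷ m))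
cut-extension         (cut l0 _ f) (cut l0 _ f') = inj₁ (l0 , (λ ()) , f , f')
cut-extension         (cut l1 _ f) (cut l1 _ f') = inj₁ (l1 , (λ ()) , f , f')
cut-extension {m} (cut l0 _ f) (cut l1 _ f') = inj₂ (factor-++⁻ˡ (l0 ∷ m) _ f , factor-++⁻ˡ (l1 ∷ m) _ f')
cut-extension {m} (cut l1 _ f) (cut l0 _ f') = inj₂ (factor-++⁻ˡ (l0 ∷ m) _ f' , factor-++⁻ˡ (l1 ∷ m) _ f)
cut-extension         (cut l2 a≢2 _) _           = ⊥-elim (a≢2 refl)
cut-extension         _ (cut l2 a≢2 _)           = ⊥-elim (a≢2 refl)

-- Antecedents

ProperSuffix : Word → Word → Set
ProperSuffix v u = ∃ λ c → IsSuffix (c ∷ v) u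

proper-suffix⇒suffix : ∀ {v u} → ProperSuffix v u → IsSuffix v u
proper-suffix⇒suffix {v} (c , x , eq) = x ++ c ∷ [] , trans (++-assoc x (c ∷ []) v) eq

proper-suffix-++ʳ : ∀ t {v u} → ProperSuffix v u → ProperSuffix (v ++ t) (u ++ t)
proper-suffix-++ʳ t {v} (c , x , refl) = c , x , sym (++-assoc x (c ∷ v) t)

proper-suffix-φ-∷ : ∀ c m → ProperSuffix (φ m) (φ (c ∷ m))
proper-suffix-φ-∷ l0 m = l1 , l0 ∷ [] , refl
proper-suffix-φ-∷ l1 m = l1 , l2 ∷ [] , refl
proper-suffix-φ-∷ l2 m = l0 , [] , refl

proper-suffix-1φ-∷ : ∀ c m → ¬ c ≡ l2 → ProperSuffix (l1 ∷ φ m) (φ (c ∷ m))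
proper-suffix-1φ-∷ l0 m _   = l0 , [] , refl
proper-suffix-1φ-∷ l1 m _   = l2 , [] , refl
proper-suffix-1φ-∷ l2 m c≢2 = ⊥-elim (c≢2 refl)

extends-left : ∀ {v u a b} → ProperSuffix v u → Extends u a b → ∃ λ c → Extends (c ∷ v) a b
extends-left (c , s) ext = c , extends-suffix s ext

-- g is (_++ l0 ∷ []) for part (1) and the identity for part (2).  Antecedents are
-- required to be proper suffixes because the letter in front of v in φ w is what extends
-- m to the left in the induction.
module Antecedents (g : Word → Word) (g-proper : ∀ {v u} → ProperSuffix v u → ProperSuffix (g v) (g u)) where

  Antecedent : Letter → Letter → Word → Set
  Antecedent e e' v = ∃ λ w → Extends w e e' × ProperSuffix v (g (φ w))

  antecedent-of-desubst : ∀ {m s e e'} → Antecedent e e' (g []) → Antecedent e e' (g (l1 ∷ [])) →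
    (Extends m e e' → ¬ m ≡ [] → ∃ λ c → Extends (c ∷ m) e e') →
    Desubst m e s → Desubst m e' s → Antecedent e e' (g (s ++ φ m))
  antecedent-of-desubst {[]} base _ _ (aligned _) (aligned _) = base
  antecedent-of-desubst {m@(_ ∷ _)} _ _ left (aligned f) (aligned f') with left (f , f') (λ ())
  ... | c , ext = c ∷ m , ext , g-proper (proper-suffix-φ-∷ c m)
  antecedent-of-desubst {m} _ base left d d'@(cut _ _ _) with cut-extension d d'
  ... | inj₁ (c , c≢2 , ext) = c ∷ m , ext , g-proper (proper-suffix-1φ-∷ c m c≢2)
  ... | inj₂ (f₀ , f₁) with left-special-head f₀ f₁
  ... | inj₁ refl = base
  ... | inj₂ (m' , refl) with left (desubst-factor d , desubst-factor d') (λ ())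
  ... | c , ext = c ∷ l2 ∷ m' , ext , g-proper (proper-suffix-1φ-∷ c (l2 ∷ m') (extends-head≢l2 ext))

module A₁₂ = Antecedents (_++ l0 ∷ []) (proper-suffix-++ʳ (l0 ∷ []))
module A₀₂ = Antecedents (λ w → w) (λ s → s)

extends-10-12 : Extends (l1 ∷ []) l0 l2
extends-10-12 = (3 , l0 ∷ l1 ∷ l2 ∷ [] , l2 ∷ l1 ∷ [] , refl) , (3 , l0 ∷ [] , l1 ∷ l0 ∷ l2 ∷ l1 ∷ [] , refl)

extends-01-02 : Extends (l0 ∷ []) l1 l2
extends-01-02 = (3 , [] , l2 ∷ l1 ∷ l0 ∷ l2 ∷ l1 ∷ [] , refl) , (3 , l0 ∷ l1 ∷ l2 ∷ l1 ∷ [] , l1 ∷ [] , refl)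

antecedent₁₂-0 : A₁₂.Antecedent l0 l2 (l0 ∷ [])
antecedent₁₂-0 = l1 ∷ [] , extends-10-12 , l1 , l2 ∷ [] , refl

antecedent₁₂-10 : A₁₂.Antecedent l0 l2 (l1 ∷ l0 ∷ [])
antecedent₁₂-10 = l1 ∷ [] , extends-10-12 , l2 , [] , refl

antecedent₀₂-ε : A₀₂.Antecedent l1 l2 []
antecedent₀₂-ε = l0 ∷ [] , extends-01-02 , l1 , l0 ∷ [] , refl

antecedent₀₂-1 : A₀₂.Antecedent l1 l2 (l1 ∷ [])
antecedent₀₂-1 = l0 ∷ [] , extends-01-02 , l0 , [] , refl

antecedent₀₂-of-desubst₀₁ : ∀ {s m} → ¬ s ++ φ m ≡ [] → Desubst m l0 s → Desubst m l1 s →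
                            A₀₂.Antecedent l1 l2 (s ++ φ m)
antecedent₀₂-of-desubst₀₁ v≢[] d₀ d₁ with extends₀₁⇒[] (desubst-factor d₀ , desubst-factor d₁)
antecedent₀₂-of-desubst₀₁ v≢[] (aligned _) _ | refl = ⊥-elim (v≢[] refl)
antecedent₀₂-of-desubst₀₁ v≢[] (cut _ _ _) _ | refl = antecedent₀₂-1

length-<-++φ-++-∷ : ∀ s m {c t} → length m < length ((s ++ φ m) ++ c ∷ t)
length-<-++φ-++-∷ s m {c} {t} = subst (λ u → length m < length u) (sym (++-assoc s (φ m) _))
  (≤-trans (length-<-φ-++-∷ m {c} {t}) (length-++-≤ʳ _ {s}))

length-<-++φ-∷ʳ0 : ∀ s m → length (m ++ l0 ∷ []) < length (s ++ φ (m ++ l0 ∷ []))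
length-<-++φ-∷ʳ0 s m = ≤-trans (length-<-φ-∷ʳ0 m) (length-++-≤ʳ _ {s})

mutual
  antecedent₁₂ : ∀ v → Acc _<_ (length v) → ¬ v ≡ [] → Extends v l1 l2 → A₁₂.Antecedent l0 l2 v
  antecedent₁₂ v (acc rs) v≢[] ext@(f₁ , f₂) with extends₁₂-∷ʳ0 v≢[] ext
  ... | v' , refl with desubst-01 v' (factor-join-∷ʳ v' f₁) | desubst-02 v' (factor-join-∷ʳ v' f₂)
  ... | s , m , refl , d₀ | s' , m' , eq , d₂ with desubst-unique eq d₀ d₂
  ... | refl , refl = A₁₂.antecedent-of-desubst antecedent₁₂-0 antecedent₁₂-10 left d₀ d₂
    where
    left : Extends m l0 l2 → ¬ m ≡ [] → ∃ λ c → Extends (c ∷ m) l0 l2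
    left ext-m m≢[] with antecedent₀₂ m (rs (length-<-++φ-++-∷ s m)) m≢[] ext-m
    ... | w , ext-w , ps = extends-left ps (φ-extends₁₂ ext-w)

  antecedent₀₂ : ∀ v → Acc _<_ (length v) → ¬ v ≡ [] → Extends v l0 l2 → A₀₂.Antecedent l1 l2 v
  antecedent₀₂ v (acc rs) v≢[] (f₀ , f₂) with desubst-2 v f₂ | desubst-0 v f₀
  ... | s , m , refl , d₁ | s' , m' , eq , e , e≢1 , d with desubst-unique eq d₁ d
  ... | refl , refl with e
  ... | l0 = antecedent₀₂-of-desubst₀₁ v≢[] d d₁
  ... | l1 = ⊥-elim (e≢1 refl)
  ... | l2 = A₀₂.antecedent-of-desubst antecedent₀₂-ε antecedent₀₂-1 left d₁ d
    where
    left : Extends m l1 l2 → ¬ m ≡ [] → ∃ λ c → Extends (c ∷ m) l1 l2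
    left ext-m m≢[] with extends₁₂-∷ʳ0 m≢[] ext-m
    ... | m'' , refl with antecedent₁₂ m (rs (length-<-++φ-∷ʳ0 s m'')) m≢[] ext-m
    ... | w , ext-w , ps = extends-left ps (φ-extends₀₂ ext-w)

antecedent-of-extends₁₂ : ∀ {v} → ¬ v ≡ [] → Extends v l1 l2 → ∃ λ w → Extends w l0 l2 × IsSuffix v (φ w ++ l0 ∷ [])
antecedent-of-extends₁₂ {v} v≢[] ext with antecedent₁₂ v (<-wellFounded (length v)) v≢[] ext
... | w , ext-w , ps = w , ext-w , proper-suffix⇒suffix ps

antecedent-of-extends₀₂ : ∀ {v} → ¬ v ≡ [] → Extends v l0 l2 → ∃ λ w → Extends w l1 l2 × IsSuffix v (φ w)
antecedent-of-extends₀₂ {v} v≢[] ext with antecedent₀₂ v (<-wellFounded (length v)) v≢[] ext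
... | w , ext-w , ps = w , ext-w , proper-suffix⇒suffix ps

right-special-characterisation : ∀ {v a b a' b'} (f : Word → Word) → ¬ a ≡ b → ¬ a' ≡ b' →
  (∀ {w} → Extends w a' b' → Extends (f w) a b) →
  (Extends v a b → ∃ λ w → Extends w a' b' × IsSuffix v (f w)) →
  (RightSpecial v × InL (v ++ a ∷ []) × InL (v ++ b ∷ []))
    ⇔ (∃ λ w → RightSpecial w × InL (w ++ a' ∷ []) × InL (w ++ b' ∷ []) × IsSuffix v (f w))
right-special-characterisation {v} {a} {b} {a'} {b'} f a≢b a'≢b' image antecedent = mk⇔ to from
  where
  to : RightSpecial v × InL (v ++ a ∷ []) × InL (v ++ b ∷ []) →
       ∃ λ w → RightSpecial w × InL (w ++ a' ∷ []) × InL (w ++ b' ∷ []) × IsSuffix v (f w)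
  to (_ , ia , ib) with antecedent (inL⇒extends ia ib)
  ... | w , ext , s with extends⇒inL ext
  ... | ia' , ib' = w , (a' , b' , a'≢b' , ia' , ib') , ia' , ib' , s
  from : (∃ λ w → RightSpecial w × InL (w ++ a' ∷ []) × InL (w ++ b' ∷ []) × IsSuffix v (f w)) →
         RightSpecial v × InL (v ++ a ∷ []) × InL (v ++ b ∷ [])
  from (w , _ , ia' , ib' , s) with extends⇒inL (extends-suffix s (image (inL⇒extends ia' ib')))
  ... | ia , ib = (a , b , a≢b , ia , ib) , ia , ib

mainTheorem5 : (v : Word) → InL v → ¬ v ≡ [] →
    ((RightSpecial v × InL (v ++ l1 ∷ []) × InL (v ++ l2 ∷ []))
      ⇔ (∃ λ w → RightSpecial w × InL (w ++ l0 ∷ []) × InL (w ++ l2 ∷ [])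
                 × IsSuffix v (φ w ++ l0 ∷ [])))
    × ((RightSpecial v × InL (v ++ l0 ∷ []) × InL (v ++ l2 ∷ []))
      ⇔ (∃ λ w → RightSpecial w × InL (w ++ l1 ∷ []) × InL (w ++ l2 ∷ [])
                 × IsSuffix v (φ w)))
mainTheorem5 v _ v≢[] =
    right-special-characterisation (λ w → φ w ++ l0 ∷ []) (λ ()) (λ ()) φ-extends₀₂ (antecedent-of-extends₁₂ v≢[])
  , right-special-characterisation φ (λ ()) (λ ()) φ-extends₁₂ (antecedent-of-extends₀₂ v≢[])
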